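{- Let $B$ be a base hierarchy and $C$ a good successor for $B$, with ${\uparrow}={\uparrow}^C_B$ and $\Uparrow^b_c=(\Uparrow^b_c)^C_B$. Let $b\geq 2$, $c\geq{\uparrow} b$, and $n=_b b^ea+r$. Then: (1) $b\mid n$ if and only if $c\mid\Uparrow^b_c n$; (2) $\Uparrow^b_c n=_c c^{\Uparrow^b_c e}\cdot{\uparrow}a+\Uparrow^b_c r$ (i.e., the right-hand side is the $c$-decomposition of $\Uparrow^b_c n$); (3) the set of $c$-digits of $\Uparrow^b_c n$ equals $\{{\uparrow}x : x \text{ is a } b\text{ -digit of } n\}$; (4) if $d\geq c$, then $\Uparrow^b_d n=\langle c\mapsto d\rangle\,\Uparrow^b_c n$.
   Context: For $b\geq 2$ and $0<n\in\mathbb N$, the $b$-decomposition of $n$ is the unique expression $n=b^ea+r$ with $0<a<b$, $r<b^e$; write $n=_b b^ea+r$. For $b\geq 2$, $x$ is a $b$-digit of $n$ if either $x=n<b$, or $n=_b b^ea+r$ and $x$ is a $b$-digit of $a$, $e$ or $r$. The (classical) base change is $\langle b\mapsto c\rangle n=n$ if $n<b$ and $\langle b\mapsto c\rangle n=c^{\langle b\mapsto c\rangle e}a+\langle b\mapsto c\rangle r$ if $n=_b b^ea+r$. For $B\subseteq\mathbb N$, $S_B(n)$ is the least $b\in B$ with $b>n$ ($\infty$ if none); every positive integer divides $\infty$. A base hierarchy is a nonempty $B\subseteq\mathbb N\setminus\{0,1\}$ with $b\mid S_B(b)$ for all $b\in B$. ${\rm Base}_B(n)=\max\{b\in B:b\leq\max\{n,\min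 B\}\}$. Upgrade: for base hierarchies $B,C$ with $\min B\leq\min C$, ${\uparrow} n={\uparrow}^C_B n\in\mathbb N\cup\{\infty\}$ is defined recursively (expressions involving $\infty$ equal $\infty$): ${\uparrow} n=n$ if $n<\min B$; otherwise with $b={\rm Base}_B(n)$, ${\uparrow} n=\Uparrow^b_c n$ for the least $c\in C$ with ${\uparrow}(n-1)<\Uparrow^b_c n<S_C(c)$, or $\infty$ if none. Here, for any $b\geq 2$ and $c,m\in\mathbb N$, the deep base change is $\Uparrow^b_c m={\uparrow} m$ if $m<b$ and $\Uparrow^b_c m=c^{\Uparrow^b_c e}\cdot{\uparrow}a+\Uparrow^b_c r$ if $m=_b b^ea+r$. $C$ is a good successor of $B$ if both are base hierarchies, $\min B\leq\min C$, ${\uparrow}^C_B n<\infty$ for all $n$, and whenever $\min B<n+1\in B$ there is no multiple of ${\rm Base}_C({\uparrow}^C_B n)$ in $({\uparrow}^C_B n,S_C({\uparrow}^C_B n))$. -}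

module Defs where

open import Level using (0ℓ)
open import Data.Nat using (ℕ; zero; suc; _+_; _*_; _∸_; _^_; _≤_; _<_)
open import Data.Nat.Divisibility using (_∣_)
open import Data.Product using (Σ; ∃; _×_; _,_)
open import Relation.Nullary using (¬_)
open import Relation.Binary.PropositionalEquality using (_≡_)
open import Data.Sum using (_⊎_)

Subset : Set₁
Subset = ℕ → Set

-- b-decomposition:  n =_b b^e a + r  means  0<a<b, r<b^e, n = b^e·a + r.
-- (For b ≥ 2 and n > 0 such e, a, r exist and are unique.)

Decomp : (b n e a r : ℕ) → Set
Decomp b n e a r = (0 < a) × (a < b) × (r < b ^ e) × (n ≡ (b ^ e * a + r))

data Digit (b : ℕ) : ℕ → ℕ → Set where
  dig-small : ∀ {n} → n < b → Digit b n n
  dig-a : ∀ {n e a r x} → Decomp b n e a r → Digit b a x → Digit b n x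
  dig-e : ∀ {n e a r x} → Decomp b n e a r → Digit b e x → Digit b n x
  dig-r : ∀ {n e a r x} → Decomp b n e a r → Digit b r x → Digit b n x

-- Classical base change:  BaseChange b c n v  means  ⟨b ↦ c⟩ n = v
-- (graph of the recursively defined function).

data BaseChange (b c : ℕ) : ℕ → ℕ → Set where
  bc-small : ∀ {n} → n < b → BaseChange b c n n
  bc-big : ∀ {n e a r e' r'} → Decomp b n e a r →
           BaseChange b c e e' → BaseChange b c r r' →
           BaseChange b c n (c ^ e' * a + r')

-- Deep base change relative to a (finite-valued) upgrade function up:
-- DeepBC up b c m v  means  ⇑^b_c m = v  (graph of the recursive def.)

data DeepBC (up : ℕ → ℕ) (b c : ℕ) : ℕ → ℕ → Set where
  dbc-small : ∀ {m} → m < b → DeepBC up b c m (up m)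
  dbc-big : ∀ {m e a r e' r'} → Decomp b m e a r →
            DeepBC up b c e e' → DeepBC up b c r r' →
            DeepBC up b c m (c ^ e' * up a + r')

-- S_B(n) = least b ∈ B with b > n (∞ if none).
-- IsSucc B n s : S_B(n) = s  (finite value s).
IsSucc : Subset → ℕ → ℕ → Set
IsSucc B n s = B s × (n < s) × (∀ b → B b → n < b → s ≤ b)

-- x < S_B(n)  (including the case S_B(n) = ∞, where it always holds):
-- x is below every element of B exceeding n.
LtS : Subset → ℕ → ℕ → Set
LtS B n x = ∀ b → B b → n < b → x < b

BelowMin : Subset → ℕ → Set
BelowMin B n = ∀ b → B b → n < b

-- Base_B(n) = max { b ∈ B : b ≤ max {n, min B} } ;  IsBase B n β : Base_B(n) = β
IsBase : Subset → ℕ → ℕ → Set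
IsBase B n β = B β × ((β ≤ n) ⊎ (∀ b → B b → β ≤ b)) × (∀ b → B b → b ≤ n → b ≤ β)

-- Base hierarchy: nonempty B ⊆ ℕ ∖ {0,1} with b ∣ S_B(b) for all b ∈ B
-- (every positive integer divides ∞, so only finite successors matter).
record BaseHierarchy (B : Subset) : Set where
  field
    nonempty : ∃ λ b → B b
    two≤     : ∀ b → B b → 2 ≤ b
    divSucc  : ∀ b → B b → ∀ s → IsSucc B b s → b ∣ s

-- Upgrade.  Since a good successor has ↑ n < ∞ for all n, ↑ is given as a
-- function up : ℕ → ℕ satisfying the defining recursion (which determines
-- it uniquely, by strong induction on n).

-- The clause for n ≥ min B, with b = Base_B(n): up n = ⇑^b_c n for the
-- least c ∈ C with ↑(n-1) < ⇑^b_c n < S_C(c).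
UpgradeStep : Subset → (ℕ → ℕ) → ℕ → ℕ → Set
UpgradeStep C up n b =
  Σ ℕ λ c → C c × DeepBC up b c n (up n) × (up (n ∸ 1) < up n) × LtS C c (up n)
    × (∀ c' → C c' → c' < c → ∀ v → DeepBC up b c' n v →
         up (n ∸ 1) < v → ¬ LtS C c' v)

record IsUpgrade (B C : Subset) (up : ℕ → ℕ) : Set where
  field
    up-low  : ∀ n → BelowMin B n → up n ≡ n
    up-high : ∀ n → (∃ λ b → B b × b ≤ n) → ∀ b → IsBase B n b → UpgradeStep C up n b

record GoodSuccessor (B C : Subset) (up : ℕ → ℕ) : Set where
  field
    hierB   : BaseHierarchy B
    hierC   : BaseHierarchy C
    minB≤minC : ∀ c → C c → ∃ λ b → B b × b ≤ c
    upgrade : IsUpgrade B C up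
    noMult  : ∀ n → (∃ λ b → B b × b < suc n) → B (suc n) →
              ∀ β → IsBase C (up n) β →
              ∀ m → up n < m → LtS C (up n) m → ¬ (β ∣ m)

-- The upgrade ↑ fixes 0 and 1 and is strictly increasing, since each upgrade step
-- requires ↑ (n - 1) < ↑ n.  Hence ⇑^b_c is strictly increasing as well: two
-- b-decompositions are compared lexicographically (exponent, leading digit,
-- remainder), and ⇑^b_c preserves each of these comparisons by induction.  As
-- ⇑^b_c (b ^ e) = c ^ (⇑^b_c e) and r < b ^ e, the remainder satisfies
-- ⇑^b_c r < c ^ (⇑^b_c e); together with 0 < ↑ a < ↑ b ≤ c this makes the defining
-- expression of ⇑^b_c n its c-decomposition, which is (2).  Uniqueness of
-- c-decompositions then lets (1), (3) and (4) be proved by well-founded induction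
-- along the decomposition of n.

module Submission where

open import Defs
open import Data.Nat using (ℕ; zero; suc; _+_; _*_; _∸_; _^_; _≤_; _<_; z≤n; s≤s; z<s; _<?_; >-nonZero)
open import Data.Nat.Properties
open import Data.Nat.Induction using (<-wellFounded)
open import Data.Nat.Divisibility using (_∣_; _∤_; _∣0; ∣-trans; m∣m*n; >⇒∤; ∣m∣n⇒∣m+n; ∣m+n∣m⇒∣n)
open import Induction.WellFounded using (Acc; acc)
open import Data.Product using (∃; ∃₂; _×_; _,_; proj₁; map₁; map₂)
open import Data.Sum using (inj₁; inj₂)
open import Data.Empty using (⊥-elim)
open import Function using (_∘_; id)
open import Function.Bundles using (_⇔_; mk⇔; module Equivalence)
open import Function.Properties.Equivalence using () renaming (trans to ⇔-trans; sym to ⇔-sym)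
open import Effect.Monad using (RawMonad)
open import Relation.Nullary using (¬_; yes; no; contradiction)
open import Relation.Nullary.Decidable using (decidable-stable; ¬¬-excluded-middle)
open import Relation.Nullary.Negation using (¬¬-Monad)
open import Relation.Binary using (tri<; tri≈; tri>)
open import Relation.Binary.PropositionalEquality

private
  variable
    q m n x y e e′ a a′ r r′ v w : ℕ

n<m^n : 1 < m → ∀ n → n < m ^ n
n<m^n 1<m zero = z<s
n<m^n {m} 1<m (suc n) = ≤-<-trans (n<m^n 1<m n) (^-monoʳ-< m 1<m (n<1+n n))

m≤m*n+o : ∀ m {n} o → 0 < n → m ≤ m * n + o
m≤m*n+o m {n} o 0<n = ≤-trans (m≤m*n m n {{>-nonZero 0<n}}) (m≤m+n (m * n) o)

m∣m^n*o : ∀ m {n} o → 0 < n → m ∣ m ^ n * o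
m∣m^n*o m {suc n} o _ = ∣-trans (m∣m*n (m ^ n)) (m∣m*n o)

1*n+0≡n : ∀ n → 1 * n + 0 ≡ n
1*n+0≡n n = trans (+-identityʳ (1 * n)) (*-identityˡ n)

∣-+-⇔ : q ∣ m → (q ∣ m + n ⇔ q ∣ n)
∣-+-⇔ q∣m = mk⇔ (λ q∣m+n → ∣m+n∣m⇒∣n q∣m+n q∣m) (∣m∣n⇒∣m+n q∣m)

¬¬-greatest : (P : ℕ → Set) → (∃ λ m → P m × m ≤ n) →
              ¬ ¬ (∃ λ β → P β × β ≤ n × (∀ m → P m → m ≤ n → m ≤ β))
¬¬-greatest {zero} P (0 , P0 , z≤n) = return (0 , P0 , z≤n , λ _ _ → id)
  where open RawMonad ¬¬-Monad
¬¬-greatest {suc n} P (m , Pm , m≤1+n) = do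
    no ¬P1+n ← ¬¬-excluded-middle
      where yes P1+n → return (suc n , P1+n , ≤-refl , λ _ _ → id)
    β , Pβ , β≤n , greatest ← ¬¬-greatest P (m , Pm , below ¬P1+n Pm m≤1+n)
    return (β , Pβ , m≤n⇒m≤1+n β≤n , λ k Pk k≤1+n → greatest k Pk (below ¬P1+n Pk k≤1+n))
  where
  open RawMonad ¬¬-Monad
  below : ∀ {k} → ¬ P (suc n) → P k → k ≤ suc n → k ≤ n
  below ¬P1+n Pk k≤1+n = m<1+n⇒m≤n (≤∧≢⇒< k≤1+n λ { refl → ¬P1+n Pk })

-- Decomp unfolds to a product in which the exponent occurs only under _^_, so it cannot
-- be inferred from a decomposition; hence the explicit {e = …} arguments throughout.

Decomp⇒0<q : Decomp q n e a r → 0 < q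
Decomp⇒0<q (0<a , a<q , _) = <-trans 0<a a<q

Decomp⇒q^e≤n : Decomp q n e a r → q ^ e ≤ n
Decomp⇒q^e≤n {q} {e = e} {r = r} (0<a , _ , _ , refl) = m≤m*n+o (q ^ e) r 0<a

Decomp⇒r<n : Decomp q n e a r → r < n
Decomp⇒r<n {e = e} d@(_ , _ , r<q^e , _) = <-≤-trans r<q^e (Decomp⇒q^e≤n {e = e} d)

Decomp⇒0<n : Decomp q n e a r → 0 < n
Decomp⇒0<n {e = e} d = ≤-<-trans z≤n (Decomp⇒r<n {e = e} d)

Decomp⇒e<n : 1 < q → Decomp q n e a r → e < n
Decomp⇒e<n {e = e} 1<q d = <-≤-trans (n<m^n 1<q e) (Decomp⇒q^e≤n {e = e} d)

leading-< : r < q ^ e → a < a′ → q ^ e * a + r < q ^ e * a′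
leading-< {r} {q} {e} {a} {a′} r<q^e a<a′ = begin-strict
  q ^ e * a + r     <⟨ +-monoʳ-< (q ^ e * a) r<q^e ⟩
  q ^ e * a + q ^ e ≡⟨ +-comm (q ^ e * a) (q ^ e) ⟩
  q ^ e + q ^ e * a ≡⟨ *-suc (q ^ e) a ⟨
  q ^ e * suc a     ≤⟨ *-monoʳ-≤ (q ^ e) a<a′ ⟩
  q ^ e * a′        ∎
  where open ≤-Reasoning

Decomp⇒n<q^1+e : Decomp q n e a r → n < q ^ suc e
Decomp⇒n<q^1+e {q} {e = e} (_ , a<q , r<q^e , refl) =
  <-≤-trans (leading-< {e = e} r<q^e a<q) (≤-reflexive (*-comm (q ^ e) q))

Decomp⇒<-larger-leading : Decomp q n e a r → a < a′ → n < q ^ e * a′ + r′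
Decomp⇒<-larger-leading {q} {e = e} {a′ = a′} {r′} (_ , _ , r<q^e , refl) a<a′ =
  <-≤-trans (leading-< {e = e} r<q^e a<a′) (m≤m+n (q ^ e * a′) r′)

Decomp⇒<-larger-exponent : Decomp q n e a r → e < e′ → 0 < a′ → n < q ^ e′ * a′ + r′
Decomp⇒<-larger-exponent {q} {n} {e} {e′ = e′} {a′} {r′} d e<e′ 0<a′ = begin-strict
  n               <⟨ Decomp⇒n<q^1+e {e = e} d ⟩
  q ^ suc e       ≤⟨ ^-monoʳ-≤ q {{>-nonZero (Decomp⇒0<q {e = e} d)}} e<e′ ⟩
  q ^ e′          ≤⟨ m≤m*n+o (q ^ e′) r′ 0<a′ ⟩
  q ^ e′ * a′ + r′ ∎
  where open ≤-Reasoning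

Decomp-<-exponent : Decomp q x e a r → Decomp q y e′ a′ r′ → e < e′ → x < y
Decomp-<-exponent dx (0<a′ , _ , _ , refl) e<e′ = Decomp⇒<-larger-exponent dx e<e′ 0<a′

Decomp-<-leading : Decomp q x e a r → Decomp q y e a′ r′ → a < a′ → x < y
Decomp-<-leading {e = e} dx (_ , _ , _ , refl) = Decomp⇒<-larger-leading {e = e} dx

Decomp-<-remainder : Decomp q x e a r → Decomp q y e a r′ → x < y → r < r′
Decomp-<-remainder {q} {e = e} {a} {r} {r′ = r′} (_ , _ , _ , refl) (_ , _ , _ , refl) =
  +-cancelˡ-< (q ^ e * a) r r′

Decomp-unique : Decomp q n e a r → Decomp q n e′ a′ r′ → e ≡ e′ × a ≡ a′ × r ≡ r′
Decomp-unique {e = e} {e′ = e′} d d′ with <-cmp e e′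
... | tri< e<e′ _ _ = contradiction (Decomp-<-exponent d d′ e<e′) (<-irrefl refl)
... | tri> _ _ e′<e = contradiction (Decomp-<-exponent d′ d e′<e) (<-irrefl refl)
Decomp-unique {e = e} {a = a} {a′ = a′} d d′ | tri≈ _ refl _ with <-cmp a a′
... | tri< a<a′ _ _ = contradiction (Decomp-<-leading {e = e} d d′ a<a′) (<-irrefl refl)
... | tri> _ _ a′<a = contradiction (Decomp-<-leading {e = e} d′ d a′<a) (<-irrefl refl)
Decomp-unique {q} {e = e} {a} {r} {r′ = r′} (_ , _ , _ , n≡) (_ , _ , _ , n≡′)
  | tri≈ _ refl _ | tri≈ _ refl _ = refl , refl , +-cancelˡ-≡ (q ^ e * a) r r′ (trans (sym n≡) n≡′)

Decomp-digit : 0 < n → n < q → Decomp q n 0 n 0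
Decomp-digit {n} 0<n n<q = 0<n , n<q , z<s , sym (1*n+0≡n n)

Decomp-power : 1 < q → ∀ e → Decomp q (q ^ e) e 1 0
Decomp-power {q} 1<q e =
  z<s , 1<q , m^n>0 q {{>-nonZero (<-trans z<s 1<q)}} e ,
  sym (trans (+-identityʳ (q ^ e * 1)) (*-identityʳ (q ^ e)))

Decomp-exponent-zero⇒∤ : Decomp q n 0 a r → q ∤ n
Decomp-exponent-zero⇒∤ {a = a} (0<a , a<q , s≤s z≤n , refl) =
  subst (_ ∤_) (sym (1*n+0≡n a)) (>⇒∤ {{>-nonZero 0<a}} a<q)

module Upgrade {B C : Subset} {up : ℕ → ℕ} (G : GoodSuccessor B C up) where
  open GoodSuccessor G using (hierB; upgrade)
  open IsUpgrade upgrade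
  open BaseHierarchy hierB using (two≤)

  up-0 : up 0 ≡ 0
  up-0 = up-low 0 λ β Bβ → <-trans z<s (two≤ β Bβ)

  up-1 : up 1 ≡ 1
  up-1 = up-low 1 two≤

  UpgradeStep⇒increasing : ∀ {β} → UpgradeStep C up n β → up (n ∸ 1) < up n
  UpgradeStep⇒increasing (_ , _ , _ , up-pred<up , _) = up-pred<up

  -- Base_B(1 + n) exists only classically; the goal is decidable, so that suffices.
  up-suc : ∀ n → up n < up (suc n)
  up-suc n = decidable-stable (up n <? up (suc n)) do
      yes reached ← ¬¬-excluded-middle
        where no unreached → return (below-min λ β Bβ → ≰⇒> (unreached ∘ (β ,_) ∘ (Bβ ,_)))
      β , Bβ , β≤1+n , greatest ← ¬¬-greatest B reached
      return (UpgradeStep⇒increasing (up-high (suc n) reached β (Bβ , inj₁ β≤1+n , greatest)))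
    where
    open RawMonad ¬¬-Monad
    below-min : BelowMin B (suc n) → up n < up (suc n)
    below-min bm rewrite up-low (suc n) bm | up-low n (λ β Bβ → <-trans (n<1+n n) (bm β Bβ)) = n<1+n n

  up-< : x < y → up x < up y
  up-< {x} {suc y} x<1+y with m≤n⇒m<n∨m≡n (m<1+n⇒m≤n x<1+y)
  ... | inj₁ x<y = <-trans (up-< x<y) (up-suc y)
  ... | inj₂ refl = up-suc y

module DeepBaseChange
  (up : ℕ → ℕ) (up-0 : up 0 ≡ 0) (up-1 : up 1 ≡ 1) (up-< : ∀ {x y} → x < y → up x < up y)
  {b : ℕ} (1<b : 1 < b) where

  private
    variable
      c d ve vr : ℕ

  0<b : 0 < b
  0<b = <-trans z<s 1<b

  up-pos : 0 < x → 0 < up x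
  up-pos {x} 0<x = subst (_< up x) up-0 (up-< 0<x)

  data Unfolding (c : ℕ) : ℕ → ℕ → Set where
    unfold-zero   : Unfolding c 0 0
    unfold-decomp : Decomp b m e a r → DeepBC up b c e ve → DeepBC up b c r vr →
                    Unfolding c m (c ^ ve * up a + vr)

  unfold : DeepBC up b c m v → Unfolding c m v
  unfold {c} (dbc-small {zero} _) = subst (Unfolding c 0) (sym up-0) unfold-zero
  unfold {c} (dbc-small {suc k} k<b) =
    subst (Unfolding c (suc k)) digit-value
      (unfold-decomp (Decomp-digit z<s k<b) (dbc-small 0<b) (dbc-small 0<b))
    where
    digit-value : c ^ up 0 * up (suc k) + up 0 ≡ up (suc k)
    digit-value rewrite up-0 = 1*n+0≡n (up (suc k))
  unfold (dbc-big d de dr) = unfold-decomp d de dr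

  deep-zero : DeepBC up b c 0 v → v ≡ 0
  deep-zero d with unfold d
  ... | unfold-zero = refl
  ... | unfold-decomp {e = e} dec _ _ = contradiction (Decomp⇒0<n {e = e} dec) λ ()

  deep-unfold-at : Decomp b m e a r → DeepBC up b c m v →
                   ∃₂ λ ve vr → DeepBC up b c e ve × DeepBC up b c r vr × v ≡ c ^ ve * up a + vr
  deep-unfold-at {e = e} dec d with unfold d
  ... | unfold-zero = contradiction (Decomp⇒0<n {e = e} dec) λ ()
  ... | unfold-decomp {e = e′} dec′ de dr with Decomp-unique {e = e} {e′ = e′} dec dec′
  ...   | refl , refl , refl = _ , _ , de , dr , refl

  deep-functional′ : Acc _<_ m → DeepBC up b c m v → DeepBC up b c m w → v ≡ w
  deep-functional′ (acc rs) d d′ with unfold d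
  ... | unfold-zero = sym (deep-zero d′)
  ... | unfold-decomp {e = e} {a = a} dec de dr with deep-unfold-at {e = e} dec d′
  ...   | _ , _ , de′ , dr′ , refl =
          cong₂ (λ ve vr → _ ^ ve * up a + vr)
            (deep-functional′ (rs (Decomp⇒e<n {e = e} 1<b dec)) de de′)
            (deep-functional′ (rs (Decomp⇒r<n {e = e} dec)) dr dr′)

  deep-functional : DeepBC up b c m v → DeepBC up b c m w → v ≡ w
  deep-functional = deep-functional′ (<-wellFounded _)

  deep-power : DeepBC up b c e v → DeepBC up b c (b ^ e) (c ^ v)
  deep-power {c} {e} {v} de =
    subst (DeepBC up b c (b ^ e)) power-value (dbc-big (Decomp-power 1<b e) de (dbc-small 0<b))
    where
    power-value : c ^ v * up 1 + up 0 ≡ c ^ v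
    power-value rewrite up-1 | up-0 = trans (+-identityʳ (c ^ v * 1)) (*-identityʳ (c ^ v))

  module Into {c : ℕ} (up-b≤c : up b ≤ c) where

    up-digit<c : x < b → up x < c
    up-digit<c x<b = <-≤-trans (up-< x<b) up-b≤c

    0<c : 0 < c
    0<c = subst (_< c) up-0 (up-digit<c 0<b)

    MonotoneBelow : ℕ → Set
    MonotoneBelow y = ∀ {x vx vy} → x < y → DeepBC up b c x vx → DeepBC up b c y vy → vx < vy

    -- Only monotonicity below b ^ e is assumed, so that deep-<′ can use this inductively.
    unfolded-Decomp : MonotoneBelow (b ^ e) → Decomp b m e a r →
                      DeepBC up b c e ve → DeepBC up b c r vr → Decomp c (c ^ ve * up a + vr) ve (up a) vr
    unfolded-Decomp mono (0<a , a<b , r<b^e , _) de dr =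
      up-pos 0<a , up-digit<c a<b , mono r<b^e dr (deep-power de) , refl

    deep-<′ : Acc _<_ y → MonotoneBelow y
    deep-<′ _ x<y _ dy with unfold dy
    ... | unfold-zero = contradiction x<y n≮0
    deep-<′ _ x<y dx _ | unfold-decomp {a = ay} {ve = vey} {vr = vry} (0<ay , _) _ _ with unfold dx
    ... | unfold-zero = <-≤-trans (m^n>0 c {{>-nonZero 0<c}} vey) (m≤m*n+o (c ^ vey) vry (up-pos 0<ay))
    deep-<′ (acc rs) x<y _ _ | unfold-decomp {e = ey} {a = ay} dy′ dey dry
                             | unfold-decomp {e = ex} {a = ax} {ve = vex} dx′ dex drx
      with unfolded-Decomp (deep-<′ (rs (≤-<-trans (Decomp⇒q^e≤n {e = ex} dx′) x<y))) dx′ dex drx | <-cmp ex ey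
    ... | dxᶜ | tri< ex<ey _ _ =
          Decomp⇒<-larger-exponent {e = vex} dxᶜ (deep-<′ (rs (Decomp⇒e<n {e = ey} 1<b dy′)) ex<ey dex dey)
            (up-pos (proj₁ dy′))
    ... | _ | tri> _ _ ey<ex = contradiction x<y (<⇒≯ (Decomp-<-exponent {e = ey} dy′ dx′ ey<ex))
    ... | dxᶜ | tri≈ _ refl _ with deep-functional dex dey | <-cmp ax ay
    ...   | refl | tri< ax<ay _ _ = Decomp⇒<-larger-leading {e = vex} dxᶜ (up-< ax<ay)
    ...   | refl | tri> _ _ ay<ax = contradiction x<y (<⇒≯ (Decomp-<-leading {e = ex} dy′ dx′ ay<ax))
    ...   | refl | tri≈ _ refl _ =
          +-monoʳ-< _
            (deep-<′ (rs (Decomp⇒r<n {e = ex} dy′)) (Decomp-<-remainder {e = ex} dx′ dy′ x<y) drx dry)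

    deep-< : MonotoneBelow y
    deep-< = deep-<′ (<-wellFounded _)

    deep-Decomp : Decomp b m e a r → DeepBC up b c m v → DeepBC up b c e ve → DeepBC up b c r vr →
                  Decomp c v ve (up a) vr
    deep-Decomp {e = e} dec dm de dr with deep-unfold-at {e = e} dec dm
    ... | _ , _ , de′ , dr′ , refl with deep-functional de de′ | deep-functional dr dr′
    ...   | refl | refl = unfolded-Decomp deep-< dec de dr

    deep-base : DeepBC up b c b c
    deep-base = subst₂ (DeepBC up b c) (^-identityʳ b) (^-identityʳ c)
                  (deep-power (subst (DeepBC up b c 1) up-1 (dbc-small 1<b)))

    deep-≤ : x ≤ y → DeepBC up b c x v → DeepBC up b c y w → v ≤ w
    deep-≤ x≤y dx dy with m≤n⇒m<n∨m≡n x≤y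
    ... | inj₁ x<y = <⇒≤ (deep-< x<y dx dy)
    ... | inj₂ refl = ≤-reflexive (deep-functional dx dy)

    deep-<c⇒<b : DeepBC up b c m v → v < c → m < b
    deep-<c⇒<b dm v<c = ≰⇒> λ b≤m → <⇒≱ v<c (deep-≤ b≤m deep-base dm)

    Decomp-of-deep : DeepBC up b c m v → Decomp c v e′ a′ r′ →
                     ∃ λ e → ∃ λ a → ∃ λ r →
                       Decomp b m e a r × a′ ≡ up a × DeepBC up b c e e′ × DeepBC up b c r r′
    Decomp-of-deep {e′ = e′} dm dv with unfold dm
    ... | unfold-zero = contradiction (Decomp⇒0<n {e = e′} dv) λ ()
    ... | unfold-decomp {ve = ve} dec de dr
      with Decomp-unique {e = ve} {e′ = e′} (unfolded-Decomp deep-< dec de dr) dv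
    ...   | refl , refl , refl = _ , _ , _ , dec , refl , de , dr

    deep-digit⁻¹ : DeepBC up b c m v → Digit c v x → ∃ λ y → Digit b m y × x ≡ up y
    deep-digit⁻¹ {m} dm (dig-small v<c) = m , dig-small m<b , deep-functional dm (dbc-small m<b)
      where m<b = deep-<c⇒<b dm v<c
    deep-digit⁻¹ dm (dig-a {e = e′} dv dx) with Decomp-of-deep {e′ = e′} dm dv
    ... | e , _ , _ , dec@(_ , a<b , _) , refl , _ , _ =
          map₂ (map₁ (dig-a {e = e} dec)) (deep-digit⁻¹ (dbc-small a<b) dx)
    deep-digit⁻¹ dm (dig-e {e = e′} dv dx) with Decomp-of-deep {e′ = e′} dm dv
    ... | e , _ , _ , dec , _ , de , _ = map₂ (map₁ (dig-e {e = e} dec)) (deep-digit⁻¹ de dx)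
    deep-digit⁻¹ dm (dig-r {e = e′} dv dx) with Decomp-of-deep {e′ = e′} dm dv
    ... | e , _ , _ , dec , _ , _ , dr = map₂ (map₁ (dig-r {e = e} dec)) (deep-digit⁻¹ dr dx)

    deep-digit : DeepBC up b c m v → Digit b m y → Digit c v (up y)
    deep-digit dm (dig-small m<b) rewrite deep-functional dm (dbc-small m<b) = dig-small (up-digit<c m<b)
    deep-digit dm (dig-a {e = e} dec@(_ , a<b , _) dy) with deep-unfold-at {e = e} dec dm
    ... | ve , _ , de , dr , refl =
          dig-a {e = ve} (unfolded-Decomp deep-< dec de dr) (deep-digit (dbc-small a<b) dy)
    deep-digit dm (dig-e {e = e} dec dy) with deep-unfold-at {e = e} dec dm
    ... | ve , _ , de , dr , refl = dig-e {e = ve} (unfolded-Decomp deep-< dec de dr) (deep-digit de dy)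
    deep-digit dm (dig-r {e = e} dec dy) with deep-unfold-at {e = e} dec dm
    ... | ve , _ , de , dr , refl = dig-r {e = ve} (unfolded-Decomp deep-< dec de dr) (deep-digit dr dy)

    deep-∣⇔′ : Acc _<_ m → DeepBC up b c m v → (b ∣ m ⇔ c ∣ v)
    deep-∣⇔′ _ dm with unfold dm
    ... | unfold-zero = mk⇔ (λ _ → c ∣0) (λ _ → b ∣0)
    ... | unfold-decomp {e = zero} dec de dr with deep-zero de
    ...   | refl = mk⇔ (⊥-elim ∘ Decomp-exponent-zero⇒∤ dec)
                       (⊥-elim ∘ Decomp-exponent-zero⇒∤ (unfolded-Decomp deep-< dec de dr))
    deep-∣⇔′ (acc rs) _ | unfold-decomp {e = suc e} {a = a} {ve = ve} dec@(_ , _ , _ , refl) de dr =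
      ⇔-trans (∣-+-⇔ (m∣m^n*o b {suc e} a z<s))
        (⇔-trans (deep-∣⇔′ (rs (Decomp⇒r<n {e = suc e} dec)) dr)
          (⇔-sym (∣-+-⇔ (m∣m^n*o c (up a) 0<ve))))
      where
      0<ve : 0 < ve
      0<ve = subst (_< ve) up-0 (deep-< z<s (dbc-small 0<b) de)

    deep-∣⇔ : DeepBC up b c m v → (b ∣ m ⇔ c ∣ v)
    deep-∣⇔ = deep-∣⇔′ (<-wellFounded _)

    deep-BaseChange′ : Acc _<_ m → DeepBC up b c m v → DeepBC up b d m w → BaseChange c d v w
    deep-BaseChange′ _ dv dw with unfold dv
    ... | unfold-zero rewrite deep-zero dw = bc-small 0<c
    deep-BaseChange′ (acc rs) _ dw | unfold-decomp {e = e} dec de dr with deep-unfold-at {e = e} dec dw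
    ... | _ , _ , de′ , dr′ , refl =
          bc-big (unfolded-Decomp deep-< dec de dr)
            (deep-BaseChange′ (rs (Decomp⇒e<n {e = e} 1<b dec)) de de′)
            (deep-BaseChange′ (rs (Decomp⇒r<n {e = e} dec)) dr dr′)

    deep-BaseChange : DeepBC up b c m v → DeepBC up b d m w → BaseChange c d v w
    deep-BaseChange = deep-BaseChange′ (<-wellFounded _)

lemma3p2 : (B C : Subset) (up : ℕ → ℕ) → GoodSuccessor B C up →
    (b c n e a r : ℕ) → 2 ≤ b → up b ≤ c → Decomp b n e a r →
    (vn ve vr : ℕ) →
    DeepBC up b c n vn → DeepBC up b c e ve → DeepBC up b c r vr →
    ((b ∣ n → c ∣ vn) × (c ∣ vn → b ∣ n))
    × Decomp c vn ve (up a) vr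
    × (∀ x → (Digit c vn x → ∃ λ y → Digit b n y × x ≡ up y)
           × ((∃ λ y → Digit b n y × x ≡ up y) → Digit c vn x))
    × (∀ d → c ≤ d → ∀ w → DeepBC up b d n w → BaseChange c d vn w)
lemma3p2 B C up G b c n e a r 2≤b up-b≤c dec vn ve vr dn de dr =
    (to (deep-∣⇔ dn) , from (deep-∣⇔ dn))
  , deep-Decomp {e = e} dec dn de dr
  , (λ x → deep-digit⁻¹ dn , λ { (y , dy , refl) → deep-digit dn dy })
  -- ⇑^b_d = ⟨c ↦ d⟩ ∘ ⇑^b_c holds for every d.
  , λ d _ w dw → deep-BaseChange dn dw
  where
  open Upgrade G
  open DeepBaseChange up up-0 up-1 up-< 2≤b
  open Into up-b≤c
  open Equivalence
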